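{- Let $G$ be a connected simple graph with vertex set $\{x_1,\dots,x_n\}$. If $\{x_{i_1},\dots,x_{i_c}\}$ is a minimal vertex cover of $G$, then for every $s\in\mathbb{N}$ the set $\{x_{i_1,t},\dots,x_{i_c,t}\mid t=0,\dots,s\}$ is a minimal vertex cover of $\mathcal{J}_s(G)$.
   Context: For a simple graph $G$ with vertex set $\{x_1,\dots,x_n\}$ and $s\in\mathbb{N}$, the $s$-jet graph $\mathcal{J}_s(G)$ is the simple graph with vertex set $\{x_{i,j}\mid i=1,\dots,n,\ j=0,\dots,s\}$ in which $\{x_{i,j},x_{k,l}\}$ is an edge if and only if $\{x_i,x_k\}$ is an edge of $G$ and $j+l\leqslant s$. A vertex cover is a set of vertices containing an endpoint of every edge; it is minimal if no proper subset is a vertex cover. -}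

module Defs where

open import Data.Nat using (ℕ; suc; _+_; _≤_)
open import Data.Fin using (Fin; toℕ)
open import Data.Bool using (Bool; true; false)
open import Data.Product using (_×_; _,_; Σ; ∃)
open import Data.Sum using (_⊎_)
open import Relation.Nullary using (¬_)
open import Relation.Binary.PropositionalEquality using (_≡_)

record Graph (V : Set) : Set₁ where
  field
    Adj      : V → V → Set
    sym      : ∀ {u v} → Adj u v → Adj v u
    irrefl   : ∀ {u} → ¬ Adj u u
open Graph public

data Reach {V : Set} (G : Graph V) : V → V → Set where
  here  : ∀ {u} → Reach G u u
  step  : ∀ {u v w} → Adj G u v → Reach G v w → Reach G u w

Connected : {V : Set} → Graph V → Set
Connected G = ∀ u v → Reach G u v

VSet : Set → Set
VSet V = V → Bool

_∈ᵥ_ : {V : Set} → V → VSet V → Set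
v ∈ᵥ C = C v ≡ true

IsVertexCover : {V : Set} → Graph V → VSet V → Set
IsVertexCover G C = ∀ u v → Adj G u v → (u ∈ᵥ C) ⊎ (v ∈ᵥ C)

_⊂ᵥ_ : {V : Set} → VSet V → VSet V → Set
T ⊂ᵥ C = (∀ v → v ∈ᵥ T → v ∈ᵥ C) × ∃ λ v → (v ∈ᵥ C) × ¬ (v ∈ᵥ T)

IsMinimalVertexCover : {V : Set} → Graph V → VSet V → Set
IsMinimalVertexCover G C =
  IsVertexCover G C × (∀ T → T ⊂ᵥ C → ¬ IsVertexCover G T)

-- The s-jet graph: vertex (i , j) stands for x_{i,j}, j = 0..s;
-- {x_{i,j}, x_{k,l}} is an edge iff {x_i,x_k} ∈ E(G) and j + l ≤ s.
jetGraph : {n : ℕ} → Graph (Fin n) → (s : ℕ) → Graph (Fin n × Fin (suc s))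
jetGraph G s = record
  { Adj    = λ { (i , j) (k , l) → Adj G i k × (toℕ j + toℕ l ≤ s) }
  ; sym    = λ { {i , j} {k , l} (e , le) → sym G e , subst≤ (toℕ j) (toℕ l) le }
  ; irrefl = λ { (e , _) → irrefl G e }
  }
  where
  open import Data.Nat.Properties using (+-comm)
  open import Relation.Binary.PropositionalEquality using (subst)
  subst≤ : ∀ a b → a + b ≤ s → b + a ≤ s
  subst≤ a b le = subst (_≤ s) (+-comm a b) le

jetSet : {n : ℕ} (s : ℕ) → VSet (Fin n) → VSet (Fin n × Fin (suc s))
jetSet s C (i , t) = C i

{-# OPTIONS --safe #-}
-- A cover missing a jet vertex x_{v,t} must contain x_{w,0} for every
-- neighbour w of v (as t + 0 ≤ s), so if it lies inside the jet set of C then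
-- every neighbour of v lies in C.  But then C ∖ {v} is still a cover of G,
-- contradicting the minimality of C.
module Submission where

open import Defs
open import Data.Nat using (ℕ; suc)
open import Data.Nat.Properties using (+-identityʳ; ≤-reflexive; ≤-trans)
open import Data.Fin using (Fin; zero; toℕ; _≟_)
open import Data.Fin.Properties using (toℕ≤pred[n])
open import Data.Bool using (false)
open import Data.Product using (_,_)
open import Data.Sum using (_⊎_; inj₁; inj₂; swap; [_,_]′)
open import Data.Empty using (⊥-elim)
open import Relation.Nullary using (¬_; Dec; yes; no)
open import Relation.Binary.Definitions using (DecidableEquality)
open import Relation.Binary.PropositionalEquality using (_≡_; refl)

module Deletion {V : Set} (_≟ᵥ_ : DecidableEquality V) where

  delete : VSet V → V → VSet V
  delete C v x with x ≟ᵥ v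
  ... | yes _ = false
  ... | no  _ = C x

  delete-≡ : (C : VSet V) (v : V) → ¬ v ∈ᵥ delete C v
  delete-≡ C v v∈ with v ≟ᵥ v
  delete-≡ C v () | yes _
  ... | no v≢v = v≢v refl

  delete-∈ : {C : VSet V} {v x : V} → x ∈ᵥ C → ¬ x ≡ v → x ∈ᵥ delete C v
  delete-∈ {v = v} {x} x∈C x≢v with x ≟ᵥ v
  ... | yes x≡v = ⊥-elim (x≢v x≡v)
  ... | no  _   = x∈C

  delete-⊆ : (C : VSet V) (v x : V) → x ∈ᵥ delete C v → x ∈ᵥ C
  delete-⊆ C v x x∈ with x ≟ᵥ v
  delete-⊆ C v x () | yes _
  ... | no _ = x∈

  delete-⊂ : (C : VSet V) {v : V} → v ∈ᵥ C → delete C v ⊂ᵥ C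
  delete-⊂ C {v} v∈C = delete-⊆ C v , v , v∈C , delete-≡ C v

  delete-isVertexCover : (G : Graph V) {C : VSet V} {v : V} →
    IsVertexCover G C → (∀ w → Adj G v w → w ∈ᵥ C) →
    IsVertexCover G (delete C v)
  delete-isVertexCover G {C} {v} cover N⊆C a b e =
    [ (λ a∈C → retain a∈C e (a ≟ᵥ v))
    , (λ b∈C → swap (retain b∈C (Graph.sym G e) (b ≟ᵥ v)))
    ]′ (cover a b e)
    where
    retain : ∀ {x y} → x ∈ᵥ C → Adj G x y → Dec (x ≡ v) →
      (x ∈ᵥ delete C v) ⊎ (y ∈ᵥ delete C v)
    retain x∈C e′ (no x≢v)  = inj₁ (delete-∈ x∈C x≢v)
    retain x∈C e′ (yes refl) =
      inj₂ (delete-∈ (N⊆C _ e′) λ { refl → irrefl G e′ })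

  minimalVertexCover⇒¬neighbours⊆ : (G : Graph V) {C : VSet V} →
    IsMinimalVertexCover G C → ∀ {v} → v ∈ᵥ C → ¬ (∀ w → Adj G v w → w ∈ᵥ C)
  minimalVertexCover⇒¬neighbours⊆ G {C} (cover , minimal) v∈C N⊆C =
    minimal (delete C _) (delete-⊂ C v∈C) (delete-isVertexCover G cover N⊆C)

open Deletion using (minimalVertexCover⇒¬neighbours⊆)

vertexCover-∌⇒neighbour∈ : {V : Set} (G : Graph V) {T : VSet V} {u w : V} →
  IsVertexCover G T → ¬ u ∈ᵥ T → Adj G u w → w ∈ᵥ T
vertexCover-∌⇒neighbour∈ G {u = u} {w} cover u∉T e with cover u w e
... | inj₁ u∈T = ⊥-elim (u∉T u∈T)
... | inj₂ w∈T = w∈T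

jetGraph-adj-zero : {n : ℕ} (G : Graph (Fin n)) (s : ℕ) {i k : Fin n} →
  Adj G i k → (t : Fin (suc s)) → Adj (jetGraph G s) (i , t) (k , zero)
jetGraph-adj-zero G s e t =
  e , ≤-trans (≤-reflexive (+-identityʳ (toℕ t))) (toℕ≤pred[n] t)

jetSet-isVertexCover : {n : ℕ} (G : Graph (Fin n)) (s : ℕ) {C : VSet (Fin n)} →
  IsVertexCover G C → IsVertexCover (jetGraph G s) (jetSet s C)
jetSet-isVertexCover G s cover (i , _) (k , _) (e , _) = cover i k e

proposition4 : (n : ℕ) (G : Graph (Fin n)) → Connected G →
    (C : VSet (Fin n)) → IsMinimalVertexCover G C →
    (s : ℕ) → IsMinimalVertexCover (jetGraph G s) (jetSet s C)
proposition4 n G _ C minC@(cover , _) s =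
  jetSet-isVertexCover G s cover , noSmallerCover
  where
  noSmallerCover : ∀ T → T ⊂ᵥ jetSet s C → ¬ IsVertexCover (jetGraph G s) T
  noSmallerCover T (T⊆ , (v , t) , v∈C , vt∉T) T-cover =
    minimalVertexCover⇒¬neighbours⊆ _≟_ G minC v∈C λ w e →
      T⊆ (w , zero)
        (vertexCover-∌⇒neighbour∈ (jetGraph G s) T-cover vt∉T
          (jetGraph-adj-zero G s e t))
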